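{- Let $m,n$ be positive integers, let $G=\mathbb{Z}/mn\mathbb{Z}$, and let $N$ be the subgroup of $G$ of order $n$. Let $R\subseteq G$ be an $(m,n,k,\lambda)$-relative difference set in $G$ relative to $N$. For $i=0,1,\ldots,n-1$ let $b_i$ be the number of elements $r\in R$ with $r\equiv i \pmod n$, and let $d=\gcd(n,m)$. Then $$\sum_{i=0}^{n-1} b_i = k, \qquad \sum_{i=0}^{n-1} b_i^2 = k+\lambda\,(m-d),$$ and $|b_i|\le m$ for every $i$.
   Context: An $(m,n,k,\lambda)$-relative difference set (RDS) in a group $G$ of order $mn$ relative to a normal subgroup $N$ of order $n$ is a $k$-subset $R$ of $G$ such that the differences $r-r'$ of distinct elements $r,r'\in R$ represent every element of $G\setminus N$ exactly $\lambda$ times and represent no non-identity element of $N$. Equivalently, in the group ring $\mathbb{Z}[G]$, $RR^{(-1)}=k+\lambda(G-N)$, where $R$ and $N$, $G$ are identified with the sums of their elements. Since $n$ divides $mn$, reduction modulo $n$ is well defined on $\mathbb{Z}/mn\mathbb{Z}$. -}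

module Defs where

open import Data.Nat using (ℕ; NonZero; _%_; _+_; _*_; _∸_; _≤_; _<_; _≤?_)
open import Data.Nat.Properties using (_≟_)
open import Data.Nat.Divisibility using (_∣_)
open import Data.List using (List; length; cartesianProduct; filter)
open import Data.List.Relation.Unary.All using (All)
open import Data.List.Relation.Unary.Unique.Propositional using (Unique)
open import Data.Product using (_×_; _,_)
open import Relation.Nullary using (¬_; yes; no)
open import Relation.Binary.PropositionalEquality using (_≡_; _≢_)

-- The group G = ℤ/Mℤ is represented by the residues {0,…,M-1} ⊆ ℕ.
-- Subtraction in ℤ/Mℤ of two residues r, r' < M.
subMod : ℕ → ℕ → ℕ → ℕ
subMod M r r' with r' ≤? r
... | yes _ = r ∸ r'
... | no  _ = (M + r) ∸ r'

diffCount : ℕ → List ℕ → ℕ → ℕ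
diffCount M R g = length (filter dec (cartesianProduct R R))
  where
  dec : (p : ℕ × ℕ) → _
  dec (r , r') with r ≟ r'
  ... | yes e = no (λ { (ne , _) → ne e })
  ... | no ne with subMod M r r' ≟ g
  ...   | yes q = yes (ne , q)
  ...   | no nq = no (λ { (_ , q) → nq q })

-- The unique subgroup of order n of ℤ/mnℤ is mℤ/mnℤ, i.e. the residues divisible by m.
inN : ℕ → ℕ → Set
inN m g = m ∣ g

record IsRDS (m n k lam : ℕ) (R : List ℕ) : Set where
  field
    inG       : All (λ r → r < m * n) R
    distinct  : Unique R
    size      : length R ≡ k
    outsideN  : ∀ g → g < m * n → ¬ inN m g → diffCount (m * n) R g ≡ lam
    insideN   : ∀ g → g < m * n → inN m g → g ≢ 0 → diffCount (m * n) R g ≡ 0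

bCount : (n : ℕ) → .{{NonZero n}} → List ℕ → ℕ → ℕ
bCount n R i = length (filter (λ r → r % n ≟ i) R)

-- Write b_i = ∑_{r ∈ R} [r ≡ i (mod n)]. Then ∑ b_i = |R| = k, while ∑ b_i² counts the pairs (r, r') ∈ R²
-- with r ≡ r' (mod n): the k pairs with r = r', and, for every multiple g of n in ℤ/mnℤ, the diffCount g pairs
-- of distinct elements with r − r' = g. By the RDS property that count is λ if m ∤ g and 0 if m ∣ g (g = 0
-- included), and exactly m − gcd(n,m) of the m multiples of n below mn are not multiples of m, since the common
-- ones are the multiples of lcm(n,m) = mn / gcd(n,m). Finally b_i ≤ m because R has no repeated elements and
-- only m residues below mn are ≡ i (mod n).

{-# OPTIONS --safe #-}
module Submission where

open import Defs
open import Data.Nat using (ℕ; NonZero; >-nonZero; >-nonZero⁻¹; zero; suc; _+_; _*_; _∸_; _^_; _≤_; _<_; _≤?_; z≤n; s≤s)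
open import Data.Nat.Properties
open import Data.Nat.DivMod using (_%_; _/_; m≡m%n+[m/n]*n; m<n⇒m%n≡m; m%n<n; %-remove-+ˡ; %-remove-+ʳ)
open import Data.Nat.Divisibility using (_∣_; _∣?_; divides; n∣m*n; ∣-refl; ∣-trans; ∣m+n∣m⇒∣n; m%n≡0⇔n∣m)
open import Data.Nat.GCD using (gcd)
open import Data.Nat.LCM using (lcm; lcm-least; m∣lcm[m,n]; n∣lcm[m,n]; gcd*lcm)
open import Data.Nat.ListAction using (sum)
open import Data.Nat.ListAction.Properties using (sum-++)
open import Data.List using (List; []; _∷_; _++_; map; upTo; length; filter; cartesianProduct)
open import Data.List.Properties using (map-++; map-∘; map-cong; map-cong-local; map-upTo)
open import Data.List.Membership.Propositional using (_∈_)
open import Data.List.Membership.Propositional.Properties using (∈-upTo⁻)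
open import Data.List.Membership.DecPropositional _≟_ using (_∈?_)
open import Data.List.Relation.Unary.All.Properties using (¬Any⇒All¬)
open import Data.List.Relation.Unary.All as All using (All)
open import Data.List.Relation.Unary.Any using (here; there)
open import Data.List.Relation.Unary.AllPairs using ([]; _∷_)
open import Data.List.Relation.Unary.Unique.Propositional using (Unique)
open import Data.Bool using (true; false; if_then_else_)
open import Data.Product using (_×_; _,_; uncurry)
open import Function using (_∘_; _⇔_; mk⇔; Equivalence)
open import Function.Properties.Equivalence using () renaming (refl to ⇔-refl)
open import Relation.Nullary using (Dec; yes; no; does; ¬_; ¬?; _×-dec_; contradiction)
open import Relation.Unary using (Pred; Decidable)
open import Relation.Binary.PropositionalEquality using (_≡_; _≢_; ≢-sym; refl; sym; trans; subst; cong; cong₂; module ≡-Reasoning)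
open import Level using (Level)
open import Algebra.Properties.CommutativeSemigroup +-commutativeSemigroup using () renaming (interchange to +-interchange)
open import Algebra.Properties.CommutativeSemigroup *-commutativeSemigroup using (xy∙z≈x∙zy)

private variable
  a b : Level
  A B C : Set a

∑ : List A → (A → ℕ) → ℕ
∑ xs f = sum (map f xs)

infixr 5 ∑
syntax ∑ xs (λ x → e) = ∑[ x ← xs ] e

∑-cong : ∀ (xs : List A) {f g : A → ℕ} → (∀ x → f x ≡ g x) → ∑ xs f ≡ ∑ xs g
∑-cong xs f≗g = cong sum (map-cong f≗g xs)

∑-cong-∈ : ∀ (xs : List A) {f g : A → ℕ} → (∀ {x} → x ∈ xs → f x ≡ g x) → ∑ xs f ≡ ∑ xs g
∑-cong-∈ xs f≗g = cong sum (map-cong-local (All.tabulate f≗g))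

∑-zero : ∀ (xs : List A) → ∑[ x ← xs ] 0 ≡ 0
∑-zero []       = refl
∑-zero (x ∷ xs) = ∑-zero xs

∑-one : ∀ (xs : List A) → ∑[ x ← xs ] 1 ≡ length xs
∑-one []       = refl
∑-one (x ∷ xs) = cong suc (∑-one xs)

∑-distrib-+ : ∀ (xs : List A) (f g : A → ℕ) → ∑[ x ← xs ] (f x + g x) ≡ ∑ xs f + ∑ xs g
∑-distrib-+ []       f g = refl
∑-distrib-+ (x ∷ xs) f g =
  trans (cong (f x + g x +_) (∑-distrib-+ xs f g)) (+-interchange (f x) (g x) _ _)

*-distribˡ-∑ : ∀ c (xs : List A) (f : A → ℕ) → c * ∑ xs f ≡ ∑[ x ← xs ] c * f x
*-distribˡ-∑ c []       f = *-zeroʳ c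
*-distribˡ-∑ c (x ∷ xs) f =
  trans (*-distribˡ-+ c (f x) (∑ xs f)) (cong (c * f x +_) (*-distribˡ-∑ c xs f))

*-distribʳ-∑ : ∀ c (xs : List A) (f : A → ℕ) → ∑ xs f * c ≡ ∑[ x ← xs ] f x * c
*-distribʳ-∑ c []       f = refl
*-distribʳ-∑ c (x ∷ xs) f =
  trans (*-distribʳ-+ c (f x) (∑ xs f)) (cong (f x * c +_) (*-distribʳ-∑ c xs f))

∑-mono-≤ : ∀ (xs : List A) {f g : A → ℕ} → (∀ x → f x ≤ g x) → ∑ xs f ≤ ∑ xs g
∑-mono-≤ []       f≤g = z≤n
∑-mono-≤ (x ∷ xs) f≤g = +-mono-≤ (f≤g x) (∑-mono-≤ xs f≤g)

∑-++ : ∀ (xs ys : List A) (f : A → ℕ) → ∑ (xs ++ ys) f ≡ ∑ xs f + ∑ ys f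
∑-++ xs ys f = trans (cong sum (map-++ f xs ys)) (sum-++ (map f xs) (map f ys))

∑-map : ∀ (g : A → B) xs (f : B → ℕ) → ∑ (map g xs) f ≡ ∑[ x ← xs ] f (g x)
∑-map g xs f = cong sum (sym (map-∘ xs))

∑-comm : ∀ (xs : List A) (ys : List B) (h : A → B → ℕ) →
         ∑[ x ← xs ] ∑[ y ← ys ] h x y ≡ ∑[ y ← ys ] ∑[ x ← xs ] h x y
∑-comm []       ys h = sym (∑-zero ys)
∑-comm (x ∷ xs) ys h = trans (cong (∑ ys (h x) +_) (∑-comm xs ys h))
                             (sym (∑-distrib-+ ys (h x) (λ y → ∑[ x ← xs ] h x y)))

∑-comm₃ : ∀ (xs : List A) (ys : List B) (zs : List C) (h : A → B → C → ℕ) →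
          ∑[ x ← xs ] ∑[ y ← ys ] ∑[ z ← zs ] h x y z ≡ ∑[ z ← zs ] ∑[ x ← xs ] ∑[ y ← ys ] h x y z
∑-comm₃ xs ys zs h = trans (∑-cong xs (λ x → ∑-comm ys zs (h x)))
                           (∑-comm xs zs (λ x z → ∑[ y ← ys ] h x y z))

∑-cartesianProduct : ∀ (xs : List A) (ys : List B) (h : A × B → ℕ) →
                     ∑ (cartesianProduct xs ys) h ≡ ∑[ x ← xs ] ∑[ y ← ys ] h (x , y)
∑-cartesianProduct []       ys h = refl
∑-cartesianProduct (x ∷ xs) ys h =
  trans (∑-++ (map (x ,_) ys) _ h) (cong₂ _+_ (∑-map (x ,_) ys h) (∑-cartesianProduct xs ys h))

∑-*-∑ : ∀ (xs : List A) (ys : List B) (f : A → ℕ) (g : B → ℕ) →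
        ∑ xs f * ∑ ys g ≡ ∑[ x ← xs ] ∑[ y ← ys ] f x * g y
∑-*-∑ xs ys f g = trans (*-distribʳ-∑ (∑ ys g) xs f) (∑-cong xs (λ x → *-distribˡ-∑ (f x) ys g))

∑-upTo-suc : ∀ n (f : ℕ → ℕ) → ∑ (upTo (suc n)) f ≡ f 0 + ∑ (upTo n) (f ∘ suc)
∑-upTo-suc n f = cong (f 0 +_) (trans (cong (λ is → ∑ is f) (sym (map-upTo suc n))) (∑-map suc (upTo n) f))

∑-upTo-+ : ∀ a b (f : ℕ → ℕ) → ∑ (upTo (a + b)) f ≡ ∑ (upTo a) f + ∑ (upTo b) (f ∘ (a +_))
∑-upTo-+ zero    b f = refl
∑-upTo-+ (suc a) b f = begin
  ∑ (upTo (suc a + b)) f                                  ≡⟨ ∑-upTo-suc (a + b) f ⟩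
  f 0 + ∑ (upTo (a + b)) (f ∘ suc)                        ≡⟨ cong (f 0 +_) (∑-upTo-+ a b (f ∘ suc)) ⟩
  f 0 + (∑ (upTo a) (f ∘ suc) + ∑ (upTo b) (f ∘ (suc a +_))) ≡⟨ +-assoc (f 0) _ _ ⟨
  f 0 + ∑ (upTo a) (f ∘ suc) + ∑ (upTo b) (f ∘ (suc a +_))   ≡⟨ cong (_+ ∑ (upTo b) (f ∘ (suc a +_))) (∑-upTo-suc a f) ⟨
  ∑ (upTo (suc a)) f + ∑ (upTo b) (f ∘ (suc a +_))          ∎
  where open ≡-Reasoning

𝟙 : {P : Set a} → Dec P → ℕ
𝟙 p = if does p then 1 else 0

𝟙-yes : {P : Set a} → P → (p : Dec P) → 𝟙 p ≡ 1
𝟙-yes _ (yes _)  = refl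
𝟙-yes x (no ¬x) = contradiction x ¬x

𝟙-no : {P : Set a} → ¬ P → (p : Dec P) → 𝟙 p ≡ 0
𝟙-no ¬x (yes x) = contradiction x ¬x
𝟙-no _  (no _)  = refl

𝟙-cong : {P : Set a} {Q : Set b} → P ⇔ Q → (p : Dec P) (q : Dec Q) → 𝟙 p ≡ 𝟙 q
𝟙-cong _   (yes _) (yes _) = refl
𝟙-cong _   (no _)  (no _)  = refl
𝟙-cong P⇔Q (yes p) (no ¬q) = contradiction (Equivalence.to P⇔Q p) ¬q
𝟙-cong P⇔Q (no ¬p) (yes q) = contradiction (Equivalence.from P⇔Q q) ¬p

𝟙-× : {P : Set a} {Q : Set b} (p : Dec P) (q : Dec Q) → 𝟙 (p ×-dec q) ≡ 𝟙 p * 𝟙 q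
𝟙-× (yes _) (yes _) = refl
𝟙-× (yes _) (no _)  = refl
𝟙-× (no _)  _       = refl

𝟙-split : {P : Set a} (p : Dec P) (x : ℕ) → x ≡ x * 𝟙 p + x * 𝟙 (¬? p)
𝟙-split (yes _) x = sym (trans (cong₂ _+_ (*-identityʳ x) (*-zeroʳ x)) (+-identityʳ x))
𝟙-split (no _)  x = sym (cong₂ _+_ (*-zeroʳ x) (*-identityʳ x))

length-filter≡∑𝟙 : {P : Pred A b} (P? : Decidable P) (xs : List A) → length (filter P? xs) ≡ ∑[ x ← xs ] 𝟙 (P? x)
length-filter≡∑𝟙 P? []       = refl
length-filter≡∑𝟙 P? (x ∷ xs) with does (P? x)
... | true  = cong suc (length-filter≡∑𝟙 P? xs)
... | false = length-filter≡∑𝟙 P? xs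

length-filter≡∑ : {P : Pred A b} (P? : Decidable P) {h : A → ℕ} → (∀ x (Px? : Dec (P x)) → 𝟙 Px? ≡ h x) →
                  (xs : List A) → length (filter P? xs) ≡ ∑ xs h
length-filter≡∑ P? 𝟙≡h xs = trans (length-filter≡∑𝟙 P? xs) (∑-cong xs (λ x → 𝟙≡h x (P? x)))

δ : ℕ → ℕ → ℕ
δ x y = 𝟙 (x ≟ y)

δ-refl : ∀ x → δ x x ≡ 1
δ-refl x = 𝟙-yes refl (x ≟ x)

δ-≢ : ∀ {x y} → x ≢ y → δ x y ≡ 0
δ-≢ {x} {y} x≢y = 𝟙-no x≢y (x ≟ y)

δ-sym : ∀ x y → δ x y ≡ δ y x
δ-sym x y = 𝟙-cong (mk⇔ sym sym) (x ≟ y) (y ≟ x)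

∑-upTo-δ : ∀ {n a} → a < n → (f : ℕ → ℕ) → ∑[ i ← upTo n ] δ a i * f i ≡ f a
∑-upTo-δ {suc n} {zero}  _         f = begin
  ∑[ i ← upTo (suc n) ] δ 0 i * f i ≡⟨ ∑-upTo-suc n (λ i → δ 0 i * f i) ⟩
  f 0 + 0 + (∑[ i ← upTo n ] 0)     ≡⟨ cong (f 0 + 0 +_) (∑-zero (upTo n)) ⟩
  f 0 + 0 + 0                       ≡⟨ trans (+-identityʳ _) (+-identityʳ _) ⟩
  f 0                               ∎
  where open ≡-Reasoning
∑-upTo-δ {suc n} {suc a} (s≤s a<n) f =
  trans (∑-upTo-suc n (λ i → δ (suc a) i * f i)) (∑-upTo-δ a<n (f ∘ suc))

∑-upTo-δ-one : ∀ {n a} → a < n → ∑[ i ← upTo n ] δ a i ≡ 1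
∑-upTo-δ-one {n} {a} a<n =
  trans (∑-cong (upTo n) (λ i → sym (*-identityʳ (δ a i)))) (∑-upTo-δ a<n (λ _ → 1))

∑-δ-≢ : ∀ {x} {xs : List ℕ} → All (x ≢_) xs → ∑[ y ← xs ] δ y x ≡ 0
∑-δ-≢ {xs = xs} x≢xs =
  trans (∑-cong-∈ xs (λ y∈xs → δ-≢ (≢-sym (All.lookup x≢xs y∈xs)))) (∑-zero xs)

∑-δ-unique-∈ : ∀ {x} {xs : List ℕ} → Unique xs → x ∈ xs → ∑[ y ← xs ] δ y x ≡ 1
∑-δ-unique-∈ {x} (x∉ys ∷ _) (here refl) = cong₂ _+_ (δ-refl x) (∑-δ-≢ x∉ys)
∑-δ-unique-∈ (y∉ys ∷ u) (there x∈ys) =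
  cong₂ _+_ (δ-≢ (All.lookup y∉ys x∈ys)) (∑-δ-unique-∈ u x∈ys)

∑-δ-unique-≤1 : ∀ {x} {xs : List ℕ} → Unique xs → ∑[ y ← xs ] δ y x ≤ 1
∑-δ-unique-≤1 {x} {xs} u with x ∈? xs
... | yes x∈xs = ≤-reflexive (∑-δ-unique-∈ u x∈xs)
... | no  x∉xs = ≤-trans (≤-reflexive (∑-δ-≢ (¬Any⇒All¬ xs x∉xs))) z≤n

∑-unique-≤-∑-upTo : ∀ {M} {xs : List ℕ} → Unique xs → All (_< M) xs → (h : ℕ → ℕ) →
                    ∑ xs h ≤ ∑ (upTo M) h
∑-unique-≤-∑-upTo {M} {xs} u xs<M h = begin
  ∑ xs h                                      ≡⟨ ∑-cong-∈ xs (λ x∈xs → ∑-upTo-δ (All.lookup xs<M x∈xs) h) ⟨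
  ∑[ x ← xs ] ∑[ g ← upTo M ] δ x g * h g     ≡⟨ ∑-comm xs (upTo M) _ ⟩
  ∑[ g ← upTo M ] ∑[ x ← xs ] δ x g * h g     ≡⟨ ∑-cong (upTo M) (λ g → *-distribʳ-∑ (h g) xs (λ x → δ x g)) ⟨
  ∑[ g ← upTo M ] (∑[ x ← xs ] δ x g) * h g   ≤⟨ ∑-mono-≤ (upTo M) (λ g → *-monoˡ-≤ (h g) (∑-δ-unique-≤1 u)) ⟩
  ∑[ g ← upTo M ] 1 * h g                     ≡⟨ ∑-cong (upTo M) (λ g → *-identityˡ (h g)) ⟩
  ∑ (upTo M) h                                ∎
  where open ≤-Reasoning

∑-upTo-residue : ∀ t {q} .{{_ : NonZero q}} {i} → i < q → ∑[ g ← upTo (t * q) ] δ (g % q) i ≡ t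
∑-upTo-residue zero          i<q = refl
∑-upTo-residue (suc t) {q} {i} i<q = begin
  ∑[ g ← upTo (q + t * q) ] δ (g % q) i
    ≡⟨ ∑-upTo-+ q (t * q) _ ⟩
  (∑[ g ← upTo q ] δ (g % q) i) + (∑[ j ← upTo (t * q) ] δ ((q + j) % q) i)
    ≡⟨ cong₂ _+_ one-period (∑-cong (upTo (t * q)) (λ j → cong (λ r → δ r i) (%-remove-+ˡ j ∣-refl))) ⟩
  1 + (∑[ j ← upTo (t * q) ] δ (j % q) i)
    ≡⟨ cong suc (∑-upTo-residue t i<q) ⟩
  suc t ∎
  where
  open ≡-Reasoning
  one-period : ∑[ g ← upTo q ] δ (g % q) i ≡ 1
  one-period = trans (∑-cong-∈ (upTo q) (λ g∈ → trans (cong (λ r → δ r i) (m<n⇒m%n≡m (∈-upTo⁻ g∈))) (δ-sym _ i)))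
                     (∑-upTo-δ-one i<q)

∑-upTo-multiples : ∀ t q .{{_ : NonZero q}} → ∑[ g ← upTo (t * q) ] 𝟙 (q ∣? g) ≡ t
∑-upTo-multiples t q =
  trans (sym (∑-cong (upTo (t * q)) (λ g → 𝟙-cong (m%n≡0⇔n∣m g q) (g % q ≟ 0) (q ∣? g))))
        (∑-upTo-residue t (>-nonZero⁻¹ q))

𝟙-∣-lcm : ∀ m n g → 𝟙 (m ∣? g) * 𝟙 (n ∣? g) ≡ 𝟙 (lcm m n ∣? g)
𝟙-∣-lcm m n g = trans (sym (𝟙-× (m ∣? g) (n ∣? g))) (𝟙-cong ∣-both⇔lcm∣ (m ∣? g ×-dec n ∣? g) (lcm m n ∣? g))
  where
  ∣-both⇔lcm∣ : (m ∣ g × n ∣ g) ⇔ lcm m n ∣ g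
  ∣-both⇔lcm∣ = mk⇔ (uncurry lcm-least)
                     (λ lcm∣g → ∣-trans (m∣lcm[m,n] m n) lcm∣g , ∣-trans (n∣lcm[m,n] m n) lcm∣g)

∑-upTo-multiples-nonmultiples : ∀ m n .{{_ : NonZero m}} .{{_ : NonZero n}} →
  ∑[ g ← upTo (m * n) ] 𝟙 (n ∣? g) * 𝟙 (¬? (m ∣? g)) ≡ m ∸ gcd n m
∑-upTo-multiples-nonmultiples m n = begin
  X                       ≡⟨ m+n∸m≡n (gcd n m) X ⟨
  gcd n m + X ∸ gcd n m   ≡⟨ cong (_∸ gcd n m) gcd+X≡m ⟩
  m ∸ gcd n m             ∎
  where
  open ≡-Reasoning
  X = ∑[ g ← upTo (m * n) ] 𝟙 (n ∣? g) * 𝟙 (¬? (m ∣? g))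
  Y = ∑[ g ← upTo (m * n) ] 𝟙 (n ∣? g) * 𝟙 (m ∣? g)
  gcd*lcm≡m*n : gcd n m * lcm n m ≡ m * n
  gcd*lcm≡m*n = trans (gcd*lcm n m) (*-comm n m)
  instance
    lcm≢0 : NonZero (lcm n m)
    lcm≢0 = m*n≢0⇒n≢0 (gcd n m) {{subst NonZero (sym gcd*lcm≡m*n) (m*n≢0 m n)}}
  Y≡gcd : Y ≡ gcd n m
  Y≡gcd = trans (∑-cong (upTo (m * n)) (𝟙-∣-lcm n m))
                (subst (λ M → ∑[ g ← upTo M ] 𝟙 (lcm n m ∣? g) ≡ gcd n m) gcd*lcm≡m*n
                       (∑-upTo-multiples (gcd n m) (lcm n m)))
  gcd+X≡m : gcd n m + X ≡ m
  gcd+X≡m = begin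
    gcd n m + X                                   ≡⟨ cong (_+ X) Y≡gcd ⟨
    Y + X                                         ≡⟨ ∑-distrib-+ (upTo (m * n)) _ _ ⟨
    ∑[ g ← upTo (m * n) ] (𝟙 (n ∣? g) * 𝟙 (m ∣? g) + 𝟙 (n ∣? g) * 𝟙 (¬? (m ∣? g)))
                                                  ≡⟨ ∑-cong (upTo (m * n)) (λ g → 𝟙-split (m ∣? g) (𝟙 (n ∣? g))) ⟨
    ∑[ g ← upTo (m * n) ] 𝟙 (n ∣? g)              ≡⟨ ∑-upTo-multiples m n ⟩
    m                                             ∎

[m+n]%d≡m%d⇒d∣n : ∀ m n d .{{_ : NonZero d}} → (m + n) % d ≡ m % d → d ∣ n
[m+n]%d≡m%d⇒d∣n m n d eq = ∣m+n∣m⇒∣n (divides ((m + n) / d) quotients) (divides (m / d) refl)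
  where
  open ≡-Reasoning
  quotients : m / d * d + n ≡ (m + n) / d * d
  quotients = +-cancelˡ-≡ (m % d) _ _ (begin
    m % d + (m / d * d + n)        ≡⟨ +-assoc (m % d) _ n ⟨
    m % d + m / d * d + n          ≡⟨ cong (_+ n) (m≡m%n+[m/n]*n m d) ⟨
    m + n                          ≡⟨ m≡m%n+[m/n]*n (m + n) d ⟩
    (m + n) % d + (m + n) / d * d  ≡⟨ cong (_+ (m + n) / d * d) eq ⟩
    m % d + (m + n) / d * d        ∎)

subMod< : ∀ {M r r'} → r < M → r' < M → subMod M r r' < M
subMod< {M} {r} {r'} r<M r'<M with r' ≤? r
... | yes _    = ≤-<-trans (m∸n≤m r r') r<M
... | no  r'≰r = m<n+o⇒m∸n<o (M + r) r' {{>-nonZero (m<n⇒0<n r<M)}}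
                   (subst (M + r <_) (+-comm M r') (+-monoʳ-< M (≰⇒> r'≰r)))

subMod≢0 : ∀ {M r r'} → r' < M → r ≢ r' → subMod M r r' ≢ 0
subMod≢0 {M} {r} {r'} r'<M r≢r' with r' ≤? r
... | yes r'≤r = λ r∸r'≡0 → r≢r' (≤-antisym (m∸n≡0⇒m≤n r∸r'≡0) r'≤r)
... | no  _    = λ M+r∸r'≡0 → <⇒≱ r'<M (≤-trans (m≤m+n M r) (m∸n≡0⇒m≤n M+r∸r'≡0))

%≡%⇔∣subMod : ∀ {M} n .{{_ : NonZero n}} → n ∣ M → ∀ r {r'} → r' < M →
              (r' % n ≡ r % n) ⇔ n ∣ subMod M r r'
%≡%⇔∣subMod {M} n n∣M r {r'} r'<M = mk⇔
  (λ r'≡r → [m+n]%d≡m%d⇒d∣n r' (subMod M r r') n (trans r'+s≡r (sym r'≡r)))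
  (λ n∣s → trans (sym (%-remove-+ʳ r' n∣s)) r'+s≡r)
  where
  r'+s≡r : (r' + subMod M r r') % n ≡ r % n
  r'+s≡r with r' ≤? r
  ... | yes r'≤r = cong (_% n) (m+[n∸m]≡n r'≤r)
  ... | no  _    = trans (cong (_% n) (m+[n∸m]≡n (≤-trans (<⇒≤ r'<M) (m≤m+n M r)))) (%-remove-+ˡ r n∣M)

δ-%-split : ∀ {M} n .{{_ : NonZero n}} → n ∣ M → ∀ r {r'} → r' < M →
            δ (r' % n) (r % n) ≡ δ r' r + 𝟙 (¬? (r ≟ r')) * 𝟙 (n ∣? subMod M r r')
δ-%-split {M} n n∣M r {r'} r'<M = by-cases (r ≟ r')
  where
  -- A plain `with r ≟ r'` would not abstract: 𝟙 (r ≟ r') has already reduced to a test on r ≡ᵇ r'.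
  by-cases : (d : Dec (r ≡ r')) → δ (r' % n) (r % n) ≡ δ r' r + 𝟙 (¬? d) * 𝟙 (n ∣? subMod M r r')
  by-cases (yes r≡r') = trans (𝟙-yes (cong (_% n) (sym r≡r')) (r' % n ≟ r % n))
                              (sym (trans (+-identityʳ _) (𝟙-yes (sym r≡r') (r' ≟ r))))
  by-cases (no  r≢r') = trans (𝟙-cong (%≡%⇔∣subMod n n∣M r r'<M) (r' % n ≟ r % n) (n ∣? subMod M r r'))
                              (sym (cong₂ _+_ (δ-≢ (r≢r' ∘ sym)) (*-identityˡ _)))

diffCount≡∑ : ∀ M R g → diffCount M R g ≡ ∑[ r ← R ] ∑[ r' ← R ] 𝟙 (¬? (r ≟ r')) * δ (subMod M r r') g
diffCount≡∑ M R g = trans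
  (length-filter≡∑ _ distinct-with-difference-g (cartesianProduct R R))
  (∑-cartesianProduct R R (λ (r , r') → 𝟙 (¬? (r ≟ r')) * δ (subMod M r r') g))
  where
  -- diffCount filters with a decision procedure local to Defs, so this holds for every decision.
  distinct-with-difference-g : ∀ ((r , r') : ℕ × ℕ) (d : Dec (r ≢ r' × subMod M r r' ≡ g)) →
                               𝟙 d ≡ 𝟙 (¬? (r ≟ r')) * δ (subMod M r r') g
  distinct-with-difference-g (r , r') d =
    trans (𝟙-cong ⇔-refl d (¬? (r ≟ r') ×-dec subMod M r r' ≟ g)) (𝟙-× (¬? (r ≟ r')) (subMod M r r' ≟ g))

diffCount-zero : ∀ {M} {R : List ℕ} → All (_< M) R → diffCount M R 0 ≡ 0
diffCount-zero {M} {R} R<M = trans (diffCount≡∑ M R 0) (trans (∑-cong R no-zero-difference) (∑-zero R))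
  where
  distinct⇒difference≢0 : ∀ r {r'} → r' < M → 𝟙 (¬? (r ≟ r')) * δ (subMod M r r') 0 ≡ 0
  distinct⇒difference≢0 r {r'} r'<M =
    trans (sym (𝟙-× (¬? (r ≟ r')) (subMod M r r' ≟ 0)))
          (𝟙-no (uncurry (subMod≢0 r'<M)) (¬? (r ≟ r') ×-dec subMod M r r' ≟ 0))
  no-zero-difference : ∀ r → ∑[ r' ← R ] 𝟙 (¬? (r ≟ r')) * δ (subMod M r r') 0 ≡ 0
  no-zero-difference r =
    trans (∑-cong-∈ R (λ r'∈R → distinct⇒difference≢0 r (All.lookup R<M r'∈R))) (∑-zero R)

∑-differences : ∀ {M} {R : List ℕ} → All (_< M) R → (f : ℕ → ℕ) →
  ∑[ r ← R ] ∑[ r' ← R ] 𝟙 (¬? (r ≟ r')) * f (subMod M r r') ≡ ∑[ g ← upTo M ] diffCount M R g * f g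
∑-differences {M} {R} R<M f = begin
  ∑[ r ← R ] ∑[ r' ← R ] 𝟙 (¬? (r ≟ r')) * f (subMod M r r')
    ≡⟨ ∑-cong-∈ R (λ {r} r∈R → ∑-cong-∈ R (λ {r'} r'∈R → cong (𝟙 (¬? (r ≟ r')) *_) (sift r∈R r'∈R))) ⟨
  ∑[ r ← R ] ∑[ r' ← R ] 𝟙 (¬? (r ≟ r')) * (∑[ g ← upTo M ] δ (subMod M r r') g * f g)
    ≡⟨ ∑-cong R (λ r → ∑-cong R (λ r' → distribute (𝟙 (¬? (r ≟ r'))) (subMod M r r'))) ⟩
  ∑[ r ← R ] ∑[ r' ← R ] ∑[ g ← upTo M ] 𝟙 (¬? (r ≟ r')) * δ (subMod M r r') g * f g
    ≡⟨ ∑-comm₃ R R (upTo M) _ ⟩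
  ∑[ g ← upTo M ] ∑[ r ← R ] ∑[ r' ← R ] 𝟙 (¬? (r ≟ r')) * δ (subMod M r r') g * f g
    ≡⟨ ∑-cong (upTo M) (λ g → trans (*-distribʳ-∑ (f g) R _) (∑-cong R (λ r → *-distribʳ-∑ (f g) R _))) ⟨
  ∑[ g ← upTo M ] (∑[ r ← R ] ∑[ r' ← R ] 𝟙 (¬? (r ≟ r')) * δ (subMod M r r') g) * f g
    ≡⟨ ∑-cong (upTo M) (λ g → cong (_* f g) (diffCount≡∑ M R g)) ⟨
  ∑[ g ← upTo M ] diffCount M R g * f g ∎
  where
  open ≡-Reasoning
  distribute : ∀ c s → c * (∑[ g ← upTo M ] δ s g * f g) ≡ ∑[ g ← upTo M ] c * δ s g * f g
  distribute c s = trans (*-distribˡ-∑ c (upTo M) (λ g → δ s g * f g))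
                         (∑-cong (upTo M) (λ g → sym (*-assoc c (δ s g) (f g))))
  sift : ∀ {r r'} → r ∈ R → r' ∈ R → ∑[ g ← upTo M ] δ (subMod M r r') g * f g ≡ f (subMod M r r')
  sift r∈R r'∈R = ∑-upTo-δ (subMod< (All.lookup R<M r∈R) (All.lookup R<M r'∈R)) f

bCount≡∑ : ∀ n .{{_ : NonZero n}} R i → bCount n R i ≡ ∑[ r ← R ] δ (r % n) i
bCount≡∑ n R i = length-filter≡∑𝟙 (λ r → r % n ≟ i) R

∑-bCount : ∀ n .{{_ : NonZero n}} R → ∑ (upTo n) (bCount n R) ≡ length R
∑-bCount n R = begin
  ∑ (upTo n) (bCount n R)                    ≡⟨ ∑-cong (upTo n) (bCount≡∑ n R) ⟩
  ∑[ i ← upTo n ] ∑[ r ← R ] δ (r % n) i     ≡⟨ ∑-comm R (upTo n) (λ r i → δ (r % n) i) ⟨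
  ∑[ r ← R ] ∑[ i ← upTo n ] δ (r % n) i     ≡⟨ ∑-cong R (λ r → ∑-upTo-δ-one (m%n<n r n)) ⟩
  ∑[ r ← R ] 1                               ≡⟨ ∑-one R ⟩
  length R                                   ∎
  where open ≡-Reasoning

bCount≤ : ∀ t n .{{_ : NonZero n}} {R} → Unique R → All (_< t * n) R → ∀ {i} → i < n → bCount n R i ≤ t
bCount≤ t n {R} u R<tn {i} i<n = begin
  bCount n R i                              ≡⟨ bCount≡∑ n R i ⟩
  ∑[ r ← R ] δ (r % n) i                    ≤⟨ ∑-unique-≤-∑-upTo u R<tn (λ g → δ (g % n) i) ⟩
  ∑[ g ← upTo (t * n) ] δ (g % n) i         ≡⟨ ∑-upTo-residue t i<n ⟩
  t                                         ∎
  where open ≤-Reasoning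

∑-bCount² : ∀ {M} n .{{_ : NonZero n}} → n ∣ M → {R : List ℕ} → Unique R → All (_< M) R →
            ∑[ i ← upTo n ] bCount n R i ^ 2 ≡ length R + (∑[ g ← upTo M ] diffCount M R g * 𝟙 (n ∣? g))
∑-bCount² {M} n n∣M {R} u R<M = begin
  ∑[ i ← upTo n ] bCount n R i ^ 2
    ≡⟨ ∑-cong (upTo n) square ⟩
  ∑[ i ← upTo n ] ∑[ r ← R ] ∑[ r' ← R ] δ (r % n) i * δ (r' % n) i
    ≡⟨ ∑-comm₃ R R (upTo n) _ ⟨
  ∑[ r ← R ] ∑[ r' ← R ] ∑[ i ← upTo n ] δ (r % n) i * δ (r' % n) i
    ≡⟨ ∑-cong R (λ r → ∑-cong R (λ r' → ∑-upTo-δ (m%n<n r n) (δ (r' % n)))) ⟩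
  ∑[ r ← R ] ∑[ r' ← R ] δ (r' % n) (r % n)
    ≡⟨ ∑-cong R (λ r → ∑-cong-∈ R (λ r'∈R → δ-%-split n n∣M r (All.lookup R<M r'∈R))) ⟩
  ∑[ r ← R ] ∑[ r' ← R ] (δ r' r + 𝟙 (¬? (r ≟ r')) * 𝟙 (n ∣? subMod M r r'))
    ≡⟨ ∑-cong R (λ r → ∑-distrib-+ R (λ r' → δ r' r) _) ⟩
  ∑[ r ← R ] ((∑[ r' ← R ] δ r' r) + (∑[ r' ← R ] 𝟙 (¬? (r ≟ r')) * 𝟙 (n ∣? subMod M r r')))
    ≡⟨ ∑-distrib-+ R _ _ ⟩
  (∑[ r ← R ] ∑[ r' ← R ] δ r' r) + (∑[ r ← R ] ∑[ r' ← R ] 𝟙 (¬? (r ≟ r')) * 𝟙 (n ∣? subMod M r r'))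
    ≡⟨ cong₂ _+_ diagonal (∑-differences R<M (λ g → 𝟙 (n ∣? g))) ⟩
  length R + (∑[ g ← upTo M ] diffCount M R g * 𝟙 (n ∣? g)) ∎
  where
  open ≡-Reasoning
  square : ∀ i → bCount n R i ^ 2 ≡ ∑[ r ← R ] ∑[ r' ← R ] δ (r % n) i * δ (r' % n) i
  square i = begin
    bCount n R i ^ 2                              ≡⟨ cong (bCount n R i *_) (*-identityʳ (bCount n R i)) ⟩
    bCount n R i * bCount n R i                   ≡⟨ cong (λ b → b * b) (bCount≡∑ n R i) ⟩
    (∑[ r ← R ] δ (r % n) i) * (∑[ r ← R ] δ (r % n) i) ≡⟨ ∑-*-∑ R R (λ r → δ (r % n) i) (λ r → δ (r % n) i) ⟩
    ∑[ r ← R ] ∑[ r' ← R ] δ (r % n) i * δ (r' % n) i ∎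
  diagonal : ∑[ r ← R ] ∑[ r' ← R ] δ r' r ≡ length R
  diagonal = trans (∑-cong-∈ R (∑-δ-unique-∈ u)) (∑-one R)

diffCount-RDS : ∀ {m n k lam R} → IsRDS m n k lam R → ∀ {g} → g < m * n →
                diffCount (m * n) R g ≡ lam * 𝟙 (¬? (m ∣? g))
diffCount-RDS {m} {n} {lam = lam} {R} rds {g} g<mn = by-cases (m ∣? g)
  where
  open IsRDS rds
  by-cases : (m∣g? : Dec (m ∣ g)) → diffCount (m * n) R g ≡ lam * 𝟙 (¬? m∣g?)
  by-cases (no  m∤g) = trans (outsideN g g<mn m∤g) (sym (*-identityʳ lam))
  by-cases (yes m∣g) = trans (inside-N (g ≟ 0)) (sym (*-zeroʳ lam))
    where
    inside-N : Dec (g ≡ 0) → diffCount (m * n) R g ≡ 0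
    inside-N (yes g≡0) = trans (cong (diffCount (m * n) R) g≡0) (diffCount-zero inG)
    inside-N (no  g≢0) = insideN g g<mn m∣g g≢0

lemma10 : (m n k lam : ℕ) → .{{_ : NonZero m}} → .{{_ : NonZero n}} → (R : List ℕ)
        → IsRDS m n k lam R
        → (sum (map (bCount n R) (upTo n)) ≡ k)
          × (sum (map (λ i → bCount n R i ^ 2) (upTo n)) ≡ k + lam * (m ∸ gcd n m))
          × (∀ i → i < n → bCount n R i ≤ m)
lemma10 m n k lam R rds = trans (∑-bCount n R) size , sum-of-squares , λ i → bCount≤ m n distinct inG
  where
  open IsRDS rds
  open ≡-Reasoning
  sum-of-squares : ∑[ i ← upTo n ] bCount n R i ^ 2 ≡ k + lam * (m ∸ gcd n m)
  sum-of-squares = begin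
    ∑[ i ← upTo n ] bCount n R i ^ 2
      ≡⟨ ∑-bCount² n (n∣m*n m) distinct inG ⟩
    length R + (∑[ g ← upTo (m * n) ] diffCount (m * n) R g * 𝟙 (n ∣? g))
      ≡⟨ cong₂ _+_ size (∑-cong-∈ (upTo (m * n)) (λ g∈ → cong (_* 𝟙 (n ∣? _)) (diffCount-RDS rds (∈-upTo⁻ g∈)))) ⟩
    k + (∑[ g ← upTo (m * n) ] lam * 𝟙 (¬? (m ∣? g)) * 𝟙 (n ∣? g))
      ≡⟨ cong (k +_) (∑-cong (upTo (m * n)) (λ g → xy∙z≈x∙zy lam (𝟙 (¬? (m ∣? g))) (𝟙 (n ∣? g)))) ⟩
    k + (∑[ g ← upTo (m * n) ] lam * (𝟙 (n ∣? g) * 𝟙 (¬? (m ∣? g))))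
      ≡⟨ cong (k +_) (*-distribˡ-∑ lam (upTo (m * n)) _) ⟨
    k + lam * (∑[ g ← upTo (m * n) ] 𝟙 (n ∣? g) * 𝟙 (¬? (m ∣? g)))
      ≡⟨ cong (λ c → k + lam * c) (∑-upTo-multiples-nonmultiples m n) ⟩
    k + lam * (m ∸ gcd n m) ∎
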